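{- Let $p<q$ be odd primes and let $E_{p,q}$ be the elliptic curve $y^2=x^3-pqx$ over $\mathbb{Q}$. Suppose there exist $a\in\mathbb{Z}$ and $b\in\mathbb{N}=\{1,2,3,\dots\}$ with $\gcd(a,b)=1$ such that at least one of the following six conditions holds: (1) $q=a^2+pb^4$; (2) $pq=a^2+b^4$; (3) $pq\,b^4=a^2+1$ (i.e. $pq=\frac{a^2+1}{b^4}$); (4) $p=qb^4-a^2$; (5) $q=pb^4-a^2$; (6) $pq=b^4-a^2$. Then $E_{p,q}$ has a non-trivial rational point, namely a point $(x,y)\in\mathbb{Q}^2$ on $E_{p,q}$ with $x\neq 0$ lying on the line $y=\frac{a}{b}x$; explicitly, $a^4+4pqb^4=c^2$ for some $c\in\mathbb{N}$, and $x=\frac{1}{2}\left(\frac{a}{b}\right)^2\pm\frac{1}{2}\sqrt{\left(\frac{a}{b}\right)^4+4pq}$, $y=\frac{a}{b}x$ are rational points of $E_{p,q}$.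
   Context: Here "non-trivial rational point" means a rational point of $E_{p,q}$ other than the point at infinity and the point $(0,0)$. The six conditions are equations in the integers $a,b,p,q$. -}

module Defs where

open import Data.Nat as ℕ using (ℕ; NonZero)
open import Data.Nat.Properties using (m*n≢0)
open import Data.Integer as ℤ using (ℤ; +_)
open import Data.Rational as ℚ using (ℚ; 0ℚ; ½; _/_)
open import Data.Product using (Σ; _×_)
open import Data.Sum using (_⊎_)
open import Relation.Binary.PropositionalEquality using (_≡_)
open import Relation.Nullary using (¬_)

pqℚ : ℕ → ℕ → ℚ
pqℚ p q = (+ (p ℕ.* q)) / 1

OnCurve : ℕ → ℕ → ℚ → ℚ → Set
OnCurve p q x y = y ℚ.* y ≡ x ℚ.* x ℚ.* x ℚ.- pqℚ p q ℚ.* x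

-- A non-trivial rational point: an affine rational point other than (0,0)
-- (the point at infinity is not affine, so it is excluded automatically).
HasNontrivialPoint : ℕ → ℕ → Set
HasNontrivialPoint p q =
  Σ ℚ λ x → Σ ℚ λ y → OnCurve p q x y × ¬ (x ≡ 0ℚ × y ≡ 0ℚ)

SixConditions : ℕ → ℕ → ℤ → ℕ → Set
SixConditions p q a b =
    (+ q ≡ a ℤ.^ 2 ℤ.+ + p ℤ.* (+ b) ℤ.^ 4)
  ⊎ (+ p ℤ.* + q ≡ a ℤ.^ 2 ℤ.+ (+ b) ℤ.^ 4)
  ⊎ (+ p ℤ.* + q ℤ.* (+ b) ℤ.^ 4 ≡ a ℤ.^ 2 ℤ.+ + 1)
  ⊎ (+ p ≡ + q ℤ.* (+ b) ℤ.^ 4 ℤ.- a ℤ.^ 2)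
  ⊎ (+ q ≡ + p ℤ.* (+ b) ℤ.^ 4 ℤ.- a ℤ.^ 2)
  ⊎ (+ p ℤ.* + q ≡ (+ b) ℤ.^ 4 ℤ.- a ℤ.^ 2)

slope : ℤ → (b : ℕ) → .{{NonZero b}} → ℚ
slope a b = a / b

-- c / b², which equals √((a/b)⁴ + 4pq) when c² = a⁴ + 4pq b⁴ and c ≥ 0.
rootTerm : ℕ → (b : ℕ) → .{{NonZero b}} → ℚ
rootTerm c b = _/_ (+ c) (b ℕ.* b) {{m*n≢0 b b}}

xPlus : ℤ → (b : ℕ) → .{{NonZero b}} → ℕ → ℚ
xPlus a b c = ½ ℚ.* (slope a b ℚ.* slope a b) ℚ.+ ½ ℚ.* rootTerm c b

xMinus : ℤ → (b : ℕ) → .{{NonZero b}} → ℕ → ℚ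
xMinus a b c = ½ ℚ.* (slope a b ℚ.* slope a b) ℚ.- ½ ℚ.* rootTerm c b

module Submission where

-- The line y = t x with t = a/b meets y² = x³ − pq x where x (x² − t² x − pq) = 0, so its
-- non-zero intersections are the roots of x² − t² x − pq; they are rational as soon as the
-- discriminant t⁴ + 4pq, i.e. (a⁴ + 4pq b⁴)/b⁴, is a rational square, and they are non-zero
-- because their product is −pq.  Each of the six conditions says pq b⁴ = u (a² + u) for an
-- integer u (namely p b⁴, b⁴, 1, −q b⁴, −p b⁴, −b⁴), and then a⁴ + 4pq b⁴ = (a² + 2u)².

open import Defs
open import Data.Nat as ℕ using (ℕ; suc; NonZero; _<_)
open import Data.Nat.Primality using (Prime; prime⇒nonZero)
open import Data.Nat.Divisibility using (_∣_)
open import Data.Nat.GCD using (gcd)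
open import Data.Nat.Properties using (m*n≢0)
open import Data.Integer as ℤ using (ℤ; +_; -[1+_]; ∣_∣; 0ℤ)
import Data.Integer.Properties as ℤ
import Data.Integer.GCD as ℤ
import Data.Integer.Solver
open import Data.Rational as ℚ using (ℚ; 0ℚ; ½; _/_; fromℚᵘ)
import Data.Rational.Properties as ℚ
open import Data.Rational.Unnormalised as ℚᵘ using (ℚᵘ; mkℚᵘ; *≡*)
import Data.Rational.Unnormalised.Properties as ℚᵘ
import Data.Rational.Solver
open import Data.Product using (Σ; _×_; _,_; proj₁; proj₂)
open import Data.Sum using (inj₁; inj₂)
open import Function using (_∘_)
open import Relation.Binary.PropositionalEquality using (_≡_; _≢_; refl; sym; trans; cong; cong₂; subst)
open import Relation.Nullary using (¬_)
open Relation.Binary.PropositionalEquality.≡-Reasoning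

module IntegerDiscriminant where
  open Data.Integer.Solver.+-*-Solver

  pqb⁴-factors : ∀ p q a b → SixConditions p q a b →
    Σ ℤ λ u → + p ℤ.* + q ℤ.* (+ b) ℤ.^ 4 ≡ u ℤ.* (a ℤ.^ 2 ℤ.+ u)
  pqb⁴-factors p q a b (inj₁ h) = + p ℤ.* (+ b) ℤ.^ 4 ,
    trans (cong (λ q → + p ℤ.* q ℤ.* (+ b) ℤ.^ 4) h)
      (solve 3 (λ a p b → p :* (a :^ 2 :+ p :* b :^ 4) :* b :^ 4 := p :* b :^ 4 :* (a :^ 2 :+ p :* b :^ 4)) refl a (+ p) (+ b))
  pqb⁴-factors p q a b (inj₂ (inj₁ h)) = (+ b) ℤ.^ 4 ,
    trans (cong (ℤ._* (+ b) ℤ.^ 4) h) (ℤ.*-comm (a ℤ.^ 2 ℤ.+ (+ b) ℤ.^ 4) ((+ b) ℤ.^ 4))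
  pqb⁴-factors p q a b (inj₂ (inj₂ (inj₁ h))) = + 1 ,
    trans h (sym (ℤ.*-identityˡ (a ℤ.^ 2 ℤ.+ + 1)))
  pqb⁴-factors p q a b (inj₂ (inj₂ (inj₂ (inj₁ h)))) = ℤ.- (+ q ℤ.* (+ b) ℤ.^ 4) ,
    trans (cong (λ p → p ℤ.* + q ℤ.* (+ b) ℤ.^ 4) h)
      (solve 3 (λ a q b → (q :* b :^ 4 :- a :^ 2) :* q :* b :^ 4 := :- (q :* b :^ 4) :* (a :^ 2 :- q :* b :^ 4)) refl a (+ q) (+ b))
  pqb⁴-factors p q a b (inj₂ (inj₂ (inj₂ (inj₂ (inj₁ h))))) = ℤ.- (+ p ℤ.* (+ b) ℤ.^ 4) ,
    trans (cong (λ q → + p ℤ.* q ℤ.* (+ b) ℤ.^ 4) h)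
      (solve 3 (λ a p b → p :* (p :* b :^ 4 :- a :^ 2) :* b :^ 4 := :- (p :* b :^ 4) :* (a :^ 2 :- p :* b :^ 4)) refl a (+ p) (+ b))
  pqb⁴-factors p q a b (inj₂ (inj₂ (inj₂ (inj₂ (inj₂ h))))) = ℤ.- (+ b) ℤ.^ 4 ,
    trans (cong (ℤ._* (+ b) ℤ.^ 4) h)
      (solve 2 (λ a b → (b :^ 4 :- a :^ 2) :* b :^ 4 := :- (b :^ 4) :* (a :^ 2 :- b :^ 4)) refl a (+ b))

  discriminant-square : ∀ a u → a ℤ.^ 4 ℤ.+ + 4 ℤ.* (u ℤ.* (a ℤ.^ 2 ℤ.+ u)) ≡ (a ℤ.^ 2 ℤ.+ + 2 ℤ.* u) ℤ.^ 2
  discriminant-square = solve 2 (λ a u → a :^ 4 :+ con (+ 4) :* (u :* (a :^ 2 :+ u)) := (a :^ 2 :+ con (+ 2) :* u) :^ 2) refl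

  ∣i∣²≡i² : ∀ i → (+ ∣ i ∣) ℤ.^ 2 ≡ i ℤ.^ 2
  ∣i∣²≡i² (+ n)    = refl
  ∣i∣²≡i² -[1+ n ] = refl

  discriminant-isSquare : ∀ p q a b → SixConditions p q a b →
    Σ ℕ λ c → a ℤ.^ 4 ℤ.+ + 4 ℤ.* + p ℤ.* + q ℤ.* (+ b) ℤ.^ 4 ≡ (+ c) ℤ.^ 2
  discriminant-isSquare p q a b six = ∣ a ℤ.^ 2 ℤ.+ + 2 ℤ.* u ∣ , (begin
    a ℤ.^ 4 ℤ.+ + 4 ℤ.* + p ℤ.* + q ℤ.* (+ b) ℤ.^ 4
      ≡⟨ solve 4 (λ a p q b → a :^ 4 :+ con (+ 4) :* p :* q :* b :^ 4 := a :^ 4 :+ con (+ 4) :* (p :* q :* b :^ 4)) refl a (+ p) (+ q) (+ b) ⟩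
    a ℤ.^ 4 ℤ.+ + 4 ℤ.* (+ p ℤ.* + q ℤ.* (+ b) ℤ.^ 4)
      ≡⟨ cong (λ z → a ℤ.^ 4 ℤ.+ + 4 ℤ.* z) factored ⟩
    a ℤ.^ 4 ℤ.+ + 4 ℤ.* (u ℤ.* (a ℤ.^ 2 ℤ.+ u))
      ≡⟨ discriminant-square a u ⟩
    (a ℤ.^ 2 ℤ.+ + 2 ℤ.* u) ℤ.^ 2
      ≡⟨ ∣i∣²≡i² (a ℤ.^ 2 ℤ.+ + 2 ℤ.* u) ⟨
    (+ ∣ a ℤ.^ 2 ℤ.+ + 2 ℤ.* u ∣) ℤ.^ 2 ∎)
    where
      u : ℤ
      u = proj₁ (pqb⁴-factors p q a b six)
      factored : + p ℤ.* + q ℤ.* (+ b) ℤ.^ 4 ≡ u ℤ.* (a ℤ.^ 2 ℤ.+ u)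
      factored = proj₂ (pqb⁴-factors p q a b six)

  -- The shape of both sides is dictated by how ℚᵘ multiplies and adds fractions: with
  -- B = + b, every denominator + (b ℕ.* …) is definitionally a product of copies of B.
  discriminant-crossMultiplied : ∀ a c X B → a ℤ.^ 4 ℤ.+ + 4 ℤ.* X ℤ.* B ℤ.^ 4 ≡ c ℤ.^ 2 →
    (c ℤ.* c) ℤ.* (B ℤ.* B ℤ.* B ℤ.* B ℤ.* (+ 1 ℤ.* + 1))
      ≡ (a ℤ.* a ℤ.* a ℤ.* a ℤ.* (+ 1 ℤ.* + 1) ℤ.+ (+ 4 ℤ.* X) ℤ.* (B ℤ.* B ℤ.* B ℤ.* B)) ℤ.* (B ℤ.* B ℤ.* (B ℤ.* B))
  discriminant-crossMultiplied a c X B h = begin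
    (c ℤ.* c) ℤ.* (B ℤ.* B ℤ.* B ℤ.* B ℤ.* (+ 1 ℤ.* + 1))
      ≡⟨ solve 2 (λ c B → (c :* c) :* (B :* B :* B :* B :* (con (+ 1) :* con (+ 1))) := c :^ 2 :* B :^ 4) refl c B ⟩
    c ℤ.^ 2 ℤ.* B ℤ.^ 4
      ≡⟨ cong (ℤ._* B ℤ.^ 4) h ⟨
    (a ℤ.^ 4 ℤ.+ + 4 ℤ.* X ℤ.* B ℤ.^ 4) ℤ.* B ℤ.^ 4
      ≡⟨ solve 3 (λ a X B → (a :^ 4 :+ con (+ 4) :* X :* B :^ 4) :* B :^ 4 :=
            (a :* a :* a :* a :* (con (+ 1) :* con (+ 1)) :+ (con (+ 4) :* X) :* (B :* B :* B :* B)) :* (B :* B :* (B :* B)))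
          refl a X B ⟩
    (a ℤ.* a ℤ.* a ℤ.* a ℤ.* (+ 1 ℤ.* + 1) ℤ.+ (+ 4 ℤ.* X) ℤ.* (B ℤ.* B ℤ.* B ℤ.* B)) ℤ.* (B ℤ.* B ℤ.* (B ℤ.* B)) ∎

open IntegerDiscriminant using (discriminant-isSquare; discriminant-crossMultiplied)

fromℚᵘ-homo-* : ∀ p q → fromℚᵘ (p ℚᵘ.* q) ≡ fromℚᵘ p ℚ.* fromℚᵘ q
fromℚᵘ-homo-* p q = ℚ.toℚᵘ-injective (ℚᵘ.≃-trans (ℚ.toℚᵘ-fromℚᵘ (p ℚᵘ.* q))
  (ℚᵘ.≃-sym (ℚᵘ.≃-trans (ℚ.toℚᵘ-homo-* (fromℚᵘ p) (fromℚᵘ q))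
    (ℚᵘ.*-cong (ℚ.toℚᵘ-fromℚᵘ p) (ℚ.toℚᵘ-fromℚᵘ q)))))

fromℚᵘ-homo-+ : ∀ p q → fromℚᵘ (p ℚᵘ.+ q) ≡ fromℚᵘ p ℚ.+ fromℚᵘ q
fromℚᵘ-homo-+ p q = ℚ.toℚᵘ-injective (ℚᵘ.≃-trans (ℚ.toℚᵘ-fromℚᵘ (p ℚᵘ.+ q))
  (ℚᵘ.≃-sym (ℚᵘ.≃-trans (ℚ.toℚᵘ-homo-+ (fromℚᵘ p) (fromℚᵘ q))
    (ℚᵘ.+-cong (ℚ.toℚᵘ-fromℚᵘ p) (ℚ.toℚᵘ-fromℚᵘ q)))))

rootTerm-square : ∀ a c p q b .{{_ : NonZero b}} →
  a ℤ.^ 4 ℤ.+ + 4 ℤ.* + p ℤ.* + q ℤ.* (+ b) ℤ.^ 4 ≡ (+ c) ℤ.^ 2 →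
  rootTerm c b ℚ.* rootTerm c b ≡ slope a b ℚ.* slope a b ℚ.* slope a b ℚ.* slope a b ℚ.+ (+ 4 / 1) ℚ.* pqℚ p q
rootTerm-square a c p q b@(suc b') disc = begin
  -- rootTerm c b and slope a b are definitionally fromℚᵘ R and fromℚᵘ T.
  fromℚᵘ R ℚ.* fromℚᵘ R
    ≡⟨ fromℚᵘ-homo-* R R ⟨
  fromℚᵘ (R ℚᵘ.* R)
    ≡⟨ ℚ.fromℚᵘ-cong {R ℚᵘ.* R} {T ℚᵘ.* T ℚᵘ.* T ℚᵘ.* T ℚᵘ.+ F ℚᵘ.* PQ}
         (*≡* (discriminant-crossMultiplied a (+ c) (+ (p ℕ.* q)) (+ b) disc′)) ⟩
  fromℚᵘ (T ℚᵘ.* T ℚᵘ.* T ℚᵘ.* T ℚᵘ.+ F ℚᵘ.* PQ)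
    ≡⟨ fromℚᵘ-homo-+ (T ℚᵘ.* T ℚᵘ.* T ℚᵘ.* T) (F ℚᵘ.* PQ) ⟩
  fromℚᵘ (T ℚᵘ.* T ℚᵘ.* T ℚᵘ.* T) ℚ.+ fromℚᵘ (F ℚᵘ.* PQ)
    ≡⟨ cong₂ ℚ._+_ fourthPower (fromℚᵘ-homo-* F PQ) ⟩
  t ℚ.* t ℚ.* t ℚ.* t ℚ.+ (+ 4 / 1) ℚ.* pqℚ p q ∎
  where
    R T F PQ : ℚᵘ
    R = mkℚᵘ (+ c) (b' ℕ.+ b' ℕ.* b)
    T = mkℚᵘ a b'
    F = mkℚᵘ (+ 4) 0
    PQ = mkℚᵘ (+ (p ℕ.* q)) 0
    t : ℚ
    t = fromℚᵘ T
    disc′ : a ℤ.^ 4 ℤ.+ + 4 ℤ.* + (p ℕ.* q) ℤ.* (+ b) ℤ.^ 4 ≡ (+ c) ℤ.^ 2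
    disc′ = trans (cong (λ z → a ℤ.^ 4 ℤ.+ z ℤ.* (+ b) ℤ.^ 4) (sym 4pq)) disc
      where
        4pq : + 4 ℤ.* + p ℤ.* + q ≡ + 4 ℤ.* + (p ℕ.* q)
        4pq = trans (ℤ.*-assoc (+ 4) (+ p) (+ q)) (cong (+ 4 ℤ.*_) (sym (ℤ.pos-* p q)))
    fourthPower : fromℚᵘ (T ℚᵘ.* T ℚᵘ.* T ℚᵘ.* T) ≡ t ℚ.* t ℚ.* t ℚ.* t
    fourthPower = begin
      fromℚᵘ (T ℚᵘ.* T ℚᵘ.* T ℚᵘ.* T)  ≡⟨ fromℚᵘ-homo-* (T ℚᵘ.* T ℚᵘ.* T) T ⟩
      fromℚᵘ (T ℚᵘ.* T ℚᵘ.* T) ℚ.* t    ≡⟨ cong (ℚ._* t) (fromℚᵘ-homo-* (T ℚᵘ.* T) T) ⟩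
      fromℚᵘ (T ℚᵘ.* T) ℚ.* t ℚ.* t      ≡⟨ cong (λ s → s ℚ.* t ℚ.* t) (fromℚᵘ-homo-* T T) ⟩
      t ℚ.* t ℚ.* t ℚ.* t                ∎

module LineThroughOrigin (t P : ℚ) where
  open import Data.Rational using (_+_; _*_; _-_; -_)
  open Data.Rational.Solver.+-*-Solver

  IsRoot : ℚ → Set
  IsRoot x = x * x ≡ t * t * x + P

  root⇒onCurve : ∀ {x} → IsRoot x → (t * x) * (t * x) ≡ x * x * x - P * x
  root⇒onCurve {x} root = begin
    (t * x) * (t * x)            ≡⟨ solve 3 (λ t x P → (t :* x) :* (t :* x) := x :* (t :* t :* x :+ P) :- P :* x) refl t x P ⟩
    x * (t * t * x + P) - P * x  ≡⟨ cong (λ y → x * y - P * x) root ⟨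
    x * (x * x) - P * x          ≡⟨ cong (_- P * x) (ℚ.*-assoc x x x) ⟨
    x * x * x - P * x            ∎

  root≢0 : ∀ {x} → IsRoot x → P ≢ 0ℚ → x ≢ 0ℚ
  root≢0 root P≢0 refl = P≢0 (begin
    P               ≡⟨ solve 2 (λ t P → P := t :* t :* con 0ℚ :+ P) refl t P ⟩
    t * t * 0ℚ + P  ≡⟨ root ⟨
    0ℚ              ∎)

  halfRoot : ∀ r → r * r ≡ t * t * t * t + (+ 4 / 1) * P → IsRoot (½ * (t * t) + ½ * r)
  halfRoot r disc = begin
    x * x
      ≡⟨ solve 2 (λ t r → let x = con ½ :* (t :* t) :+ con ½ :* r in
                    x :* x := t :* t :* x :+ con ½ :* con ½ :* (r :* r :- t :* t :* t :* t)) refl t r ⟩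
    t * t * x + ½ * ½ * (r * r - t * t * t * t)
      ≡⟨ cong (λ s → t * t * x + ½ * ½ * (s - t * t * t * t)) disc ⟩
    t * t * x + ½ * ½ * (t * t * t * t + (+ 4 / 1) * P - t * t * t * t)
      ≡⟨ cong (_+_ (t * t * x)) (solve 2 (λ s P → con ½ :* con ½ :* (s :+ con (+ 4 / 1) :* P :- s) := P) refl (t * t * t * t) P) ⟩
    t * t * x + P
      ∎
    where
      x : ℚ
      x = ½ * (t * t) + ½ * r

  halfRoots : ∀ r → r * r ≡ t * t * t * t + (+ 4 / 1) * P →
    IsRoot (½ * (t * t) + ½ * r) × IsRoot (½ * (t * t) - ½ * r)
  halfRoots r disc = halfRoot r disc , subst IsRoot (cong (_+_ (½ * (t * t))) (sym (ℚ.neg-distribʳ-* ½ r))) root₋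
    where
      root₋ : IsRoot (½ * (t * t) + ½ * - r)
      root₋ = halfRoot (- r) (trans (solve 1 (λ r → (:- r) :* (:- r) := r :* r) refl r) disc)

open LineThroughOrigin using (IsRoot; root⇒onCurve; root≢0; halfRoots)

i/1≡0⇒i≡0 : ∀ i → i / 1 ≡ 0ℚ → i ≡ 0ℤ
i/1≡0⇒i≡0 i i/1≡0 = begin
  i                                   ≡⟨ ℚ.↥-/ i 1 ⟨
  ℚ.↥ (i / 1) ℤ.* ℤ.gcd i (+ 1)       ≡⟨ cong (ℤ._* ℤ.gcd i (+ 1)) (ℚ.p≡0⇒↥p≡0 (i / 1) i/1≡0) ⟩
  0ℤ ℤ.* ℤ.gcd i (+ 1)                ≡⟨ ℤ.*-zeroˡ (ℤ.gcd i (+ 1)) ⟩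
  0ℤ                                  ∎

pqℚ≢0 : ∀ p q .{{_ : NonZero p}} .{{_ : NonZero q}} → pqℚ p q ≢ 0ℚ
pqℚ≢0 p q pq≡0 = ℕ.≢-nonZero⁻¹ (p ℕ.* q) {{m*n≢0 p q}} (ℤ.+-injective (i/1≡0⇒i≡0 (+ (p ℕ.* q)) pq≡0))

mainTheorem1 : (p q : ℕ) → Prime p → Prime q → ¬ (2 ∣ p) → ¬ (2 ∣ q) → p < q →
    (a : ℤ) (b : ℕ) → .{{_ : NonZero b}} → gcd ∣ a ∣ b ≡ 1 →
    SixConditions p q a b →
    HasNontrivialPoint p q
    × Σ ℕ (λ c →
        (a ℤ.^ 4 ℤ.+ + 4 ℤ.* + p ℤ.* + q ℤ.* (+ b) ℤ.^ 4 ≡ (+ c) ℤ.^ 2)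
        × (OnCurve p q (xPlus a b c) (slope a b ℚ.* xPlus a b c) × xPlus a b c ≢ 0ℚ)
        × (OnCurve p q (xMinus a b c) (slope a b ℚ.* xMinus a b c) × xMinus a b c ≢ 0ℚ))
mainTheorem1 p q p-prime q-prime _ _ _ a b _ six with discriminant-isSquare p q a b six
... | c , disc =
    (xPlus a b c , t ℚ.* xPlus a b c , onCurve₊ , x₊≢0 ∘ proj₁)
  , c , disc , (onCurve₊ , x₊≢0) , (onCurve₋ , x₋≢0)
  where
    instance
      _ = prime⇒nonZero p-prime
      _ = prime⇒nonZero q-prime
    t P : ℚ
    t = slope a b
    P = pqℚ p q
    roots : IsRoot t P (xPlus a b c) × IsRoot t P (xMinus a b c)
    roots = halfRoots t P (rootTerm c b) (rootTerm-square a c p q b disc)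
    onCurve₊ : OnCurve p q (xPlus a b c) (t ℚ.* xPlus a b c)
    onCurve₊ = root⇒onCurve t P (proj₁ roots)
    onCurve₋ : OnCurve p q (xMinus a b c) (t ℚ.* xMinus a b c)
    onCurve₋ = root⇒onCurve t P (proj₂ roots)
    x₊≢0 : xPlus a b c ≢ 0ℚ
    x₊≢0 = root≢0 t P (proj₁ roots) (pqℚ≢0 p q)
    x₋≢0 : xMinus a b c ≢ 0ℚ
    x₋≢0 = root≢0 t P (proj₂ roots) (pqℚ≢0 p q)
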